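{- Let $\mathscr{A}=(Q,\Sigma,\delta)$ be an aperiodically $1$-contracting DFA with state set $Q=\{q_1,\ldots,q_n\}$, and let $W=\{w_1,\ldots,w_n\}$ be a $1$-contracting collection with $w_i$ excluding $q_i$ and with $\sigma_W$ a cyclic permutation of $Q$. Define the collections $\mathscr{S}_{k,i},\mathscr{T}_k,\mathscr{U}_{k,i}$ as in the context. Then for every $1\le k\le n-1$ and every $S\in\mathscr{T}_k$ there exists a word $w_S$ of the form $w_S=w_{i_1}\cdots w_{i_k}$ (with $i_1,\ldots,i_k\in\{1,\ldots,n\}$) such that $\delta(Q,w_S)=S$.
   Context: DFA $\mathscr{A}=(Q,\Sigma,\delta)$, transition function extended to words and to subsets by $\delta(S,w)=\{\delta(q,w)\mid q\in S\}$; $\delta^{ -1}(q,w)=\{p\in Q\mid\delta(p,w)=q\}$. A word $w$ is $1$-deficient excluding $q$ if $\delta(Q,w)=Q\setminus\{q\}$; then exactly one state $q^c$ has $|\delta^{ -1}(q^c,w)|=2$ (its contracting state). A $1$-contracting collection contains, for each $q\in Q$, exactly one $1$-deficient word excluding $q$; its state map $\sigma_W$ sends $q$ to the contracting state of that word. $\mathscr{A}$ is aperiodically $1$-contracting if some such $W$ has $\sigma_W$ a cyclic permutation (single $n$-cycle). Write $q_i^c=\sigma_W(q_i)$, the contracting state of $w_i$. Define $\mathscr{S}_{0,i}=\mathscr{T}_0=\mathscr{U}_{0,i}=\{Q\}$ for all $i$, and recursively for $k=1,\ldots,n-1$: $\mathscr{S}_{k,i}=\{\delta(S,w_i)\mid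 S\in\mathscr{U}_{k-1,i}\}$, $\mathscr{T}_k=\bigcup_{i=1}^n\mathscr{S}_{k,i}$, $\mathscr{U}_{k,i}=\{S\in\mathscr{T}_k\mid \delta^{ -1}(q_i^c,w_i)\subseteq S\}$. -}

module Defs where

open import Data.Nat using (ℕ; zero; suc)
open import Data.Fin using (Fin)
open import Data.Fin.Subset using (Subset; _∈_; _⊆_; ⊤; ∣_∣)
open import Data.Fin.Subset.Properties using (_∈?_)
open import Data.Fin.Properties using (any?; _≟_)
open import Data.List using (List; foldl)
open import Data.Vec using (tabulate)
open import Data.Product using (Σ; ∃; _×_; _,_)
open import Relation.Nullary.Decidable using (⌊_⌋; _×-dec_)
open import Relation.Binary.PropositionalEquality using (_≡_)
open import Function.Definitions using (Injective)

-- A DFA with state set Q = Fin n and finite alphabet Σ = Fin m: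
-- a transition function  δ : Q → Σ → Q.
Word : ℕ → Set
Word m = List (Fin m)

δ* : ∀ {n m} → (Fin n → Fin m → Fin n) → Fin n → Word m → Fin n
δ* δ = foldl δ

image : ∀ {n m} → (Fin n → Fin m → Fin n) → Subset n → Word m → Subset n
image δ S w = tabulate λ q → ⌊ any? (λ p → (p ∈? S) ×-dec (δ* δ p w ≟ q)) ⌋

preimage : ∀ {n m} → (Fin n → Fin m → Fin n) → Fin n → Word m → Subset n
preimage δ q w = tabulate λ p → ⌊ δ* δ p w ≟ q ⌋

Excludes : ∀ {n m} → (Fin n → Fin m → Fin n) → Word m → Fin n → Set
Excludes δ w q = ∀ r → (r ∈ image δ ⊤ w → r ≡ q → Data.Empty.⊥)
                      × ((r ≡ q → Data.Empty.⊥) → r ∈ image δ ⊤ w)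
  where import Data.Empty

ContractingState : ∀ {n m} → (Fin n → Fin m → Fin n) → Word m → Fin n → Set
ContractingState δ w q = ∣ preimage δ q w ∣ ≡ 2

iter : ∀ {n} → (Fin n → Fin n) → ℕ → Fin n → Fin n
iter f zero x = x
iter f (suc k) x = f (iter f k x)

-- σ is a cyclic permutation of Fin n (a single n-cycle): a bijection
-- (injective self-map of a finite set) whose orbit from any state is everything.
IsCyclicPerm : ∀ {n} → (Fin n → Fin n) → Set
IsCyclicPerm σ = Injective _≡_ _≡_ σ × (∀ p q → ∃ λ k → iter σ k p ≡ q)

-- The collections 𝒮_{k,i}, 𝒯_k, 𝒰_{k,i} as predicates on subsets,
-- for a DFA δ, words w : Fin n → Word m (w i excludes state i) and
-- contracting-state map c (c i = q_i^c).
module Collections {n m : ℕ} (δ : Fin n → Fin m → Fin n)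
                   (w : Fin n → Word m) (c : Fin n → Fin n) where

  𝒯 : ℕ → Subset n → Set
  𝒰 : ℕ → Fin n → Subset n → Set
  𝒮 : ℕ → Fin n → Subset n → Set

  𝒮 zero i S = S ≡ ⊤
  𝒮 (suc k) i S = Σ (Subset n) λ S′ → 𝒰 k i S′ × (S ≡ image δ S′ (w i))

  𝒯 zero S = S ≡ ⊤
  𝒯 (suc k) S = Σ (Fin n) λ i → 𝒮 (suc k) i S

  𝒰 zero i S = S ≡ ⊤
  𝒰 (suc k) i S = 𝒯 (suc k) S × (preimage δ (c i) (w i) ⊆ S)

module Submission where

-- The collections are built by repeatedly applying words of W to earlier
-- members, starting from Q, and δ(S, u) is functorial in the word:
-- δ(δ(S, u), v) = δ(S, uv) and δ(S, ε) = S.  Hence a straightforward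
-- induction on k, carried out simultaneously for 𝒯_k and 𝒰_{k,i} (which
-- is a subcollection of 𝒯_k), produces the word w_S.

open import Defs
open import Data.Nat using (ℕ; _≤_; _<_; zero; suc)
open import Data.Fin using (Fin)
open import Data.Fin.Subset using (Subset; ⊤; _∈_)
open import Data.Fin.Subset.Properties using (_∈?_; ⊆-antisym)
open import Data.Fin.Properties using (any?; _≟_)
open import Data.List using (concat; _++_; []; [_])
open import Data.List.Properties using (foldl-++; concat-++; ++-identityʳ)
open import Data.Vec using (Vec; toList; map; _∷ʳ_; tabulate)
open import Data.Vec.Properties using (toList-∷ʳ; map-∷ʳ; lookup∘tabulate; []=⇒lookup; lookup⇒[]=)
open import Data.Product using (Σ; ∃; _×_; _,_)
open import Data.Bool using (true)
open import Relation.Nullary using (Dec; yes; no)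
open import Relation.Nullary.Decidable using (⌊_⌋; _×-dec_)
open import Relation.Binary.PropositionalEquality using (_≡_; refl; sym; trans; cong; module ≡-Reasoning)
open import Data.Empty using (⊥-elim)

module _ {n : ℕ} {P : Fin n → Set} (P? : ∀ q → Dec (P q)) where

  ∈-decided⁻ : ∀ {q} → q ∈ tabulate (λ q → ⌊ P? q ⌋) → P q
  ∈-decided⁻ {q} q∈ with P? q | trans (sym (lookup∘tabulate _ q)) ([]=⇒lookup q∈)
  ... | yes Pq | _ = Pq
  ... | no _  | ()

  ∈-decided⁺ : ∀ {q} → P q → q ∈ tabulate (λ q → ⌊ P? q ⌋)
  ∈-decided⁺ {q} Pq = lookup⇒[]= q _ (trans (lookup∘tabulate _ q) decided)
    where
    decided : ⌊ P? q ⌋ ≡ true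
    decided with P? q
    ... | yes _  = refl
    ... | no ¬Pq = ⊥-elim (¬Pq Pq)

module Image {n m : ℕ} (δ : Fin n → Fin m → Fin n) where

  ∈-image⁻ : ∀ {S u q} → q ∈ image δ S u → ∃ λ p → p ∈ S × δ* δ p u ≡ q
  ∈-image⁻ {S} {u} {q} = ∈-decided⁻ (λ q → any? (λ p → (p ∈? S) ×-dec (δ* δ p u ≟ q)))

  ∈-image⁺ : ∀ {S} u {p} → p ∈ S → δ* δ p u ∈ image δ S u
  ∈-image⁺ {S} u {p} p∈S =
    ∈-decided⁺ (λ q → any? (λ p → (p ∈? S) ×-dec (δ* δ p u ≟ q))) (p , p∈S , refl)

  image-[] : ∀ S → image δ S [] ≡ S
  image-[] S = ⊆-antisym image⊆S S⊆image
    where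
    image⊆S : ∀ {q} → q ∈ image δ S [] → q ∈ S
    image⊆S q∈ with ∈-image⁻ {S} {[]} q∈
    ... | p , p∈S , refl = p∈S

    S⊆image : ∀ {q} → q ∈ S → q ∈ image δ S []
    S⊆image = ∈-image⁺ []

  image-++ : ∀ S u v → image δ (image δ S u) v ≡ image δ S (u ++ v)
  image-++ S u v = ⊆-antisym stepwise⊆joint joint⊆stepwise
    where
    stepwise⊆joint : ∀ {q} → q ∈ image δ (image δ S u) v → q ∈ image δ S (u ++ v)
    stepwise⊆joint q∈ with ∈-image⁻ {image δ S u} {v} q∈
    ... | r , r∈ , refl with ∈-image⁻ {S} {u} r∈
    ...   | p , p∈S , refl rewrite sym (foldl-++ δ p u v) = ∈-image⁺ (u ++ v) p∈S

    joint⊆stepwise : ∀ {q} → q ∈ image δ S (u ++ v) → q ∈ image δ (image δ S u) v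
    joint⊆stepwise q∈ with ∈-image⁻ {S} {u ++ v} q∈
    ... | p , p∈S , refl rewrite foldl-++ δ p u v = ∈-image⁺ v (∈-image⁺ u p∈S)

product : ∀ {n m k} → (Fin n → Word m) → Vec (Fin n) k → Word m
product w is = concat (toList (map w is))

product-∷ʳ : ∀ {n m k} (w : Fin n → Word m) (is : Vec (Fin n) k) i →
             product w (is ∷ʳ i) ≡ product w is ++ w i
product-∷ʳ w is i = begin
  concat (toList (map w (is ∷ʳ i)))          ≡⟨ cong (λ v → concat (toList v)) (map-∷ʳ w i is) ⟩
  concat (toList (map w is ∷ʳ w i))          ≡⟨ cong concat (toList-∷ʳ (w i) (map w is)) ⟩
  concat (toList (map w is) ++ [ w i ])      ≡⟨ sym (concat-++ (toList (map w is)) _) ⟩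
  product w is ++ (w i ++ [])                ≡⟨ cong (product w is ++_) (++-identityʳ (w i)) ⟩
  product w is ++ w i                        ∎
  where open ≡-Reasoning

module Reachability {n m : ℕ} (δ : Fin n → Fin m → Fin n)
                    (w : Fin n → Word m) (c : Fin n → Fin n) where

  open Image δ
  open Collections δ w c

  ReachableIn : ℕ → Subset n → Set
  ReachableIn k S = Σ (Vec (Fin n) k) λ is → image δ ⊤ (product w is) ≡ S

  ⊤-reachable : ReachableIn 0 ⊤
  ⊤-reachable = Data.Vec.[] , image-[] ⊤

  reachable-step : ∀ {k S} i → ReachableIn k S → ReachableIn (suc k) (image δ S (w i))
  reachable-step {S = S} i (is , Q·is≡S) = is ∷ʳ i , (begin
    image δ ⊤ (product w (is ∷ʳ i))        ≡⟨ cong (image δ ⊤) (product-∷ʳ w is i) ⟩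
    image δ ⊤ (product w is ++ w i)        ≡⟨ sym (image-++ ⊤ (product w is) (w i)) ⟩
    image δ (image δ ⊤ (product w is)) (w i) ≡⟨ cong (λ X → image δ X (w i)) Q·is≡S ⟩
    image δ S (w i)                        ∎)
    where open ≡-Reasoning

  𝒯-reachable : ∀ k {S} → 𝒯 k S → ReachableIn k S
  𝒰-reachable : ∀ k i {S} → 𝒰 k i S → ReachableIn k S

  𝒯-reachable zero refl = ⊤-reachable
  𝒯-reachable (suc k) (i , S′ , S′∈𝒰 , refl) = reachable-step i (𝒰-reachable k i S′∈𝒰)

  𝒰-reachable zero i refl = ⊤-reachable
  𝒰-reachable (suc k) i (S∈𝒯 , _) = 𝒯-reachable (suc k) S∈𝒯

lemma2 : {n m : ℕ} (δ : Fin n → Fin m → Fin n)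
    (w : Fin n → Word m) (c : Fin n → Fin n)
    → (∀ i → Excludes δ (w i) i)
    → (∀ i → ContractingState δ (w i) (c i))
    → IsCyclicPerm c
    → (k : ℕ) → 1 ≤ k → k < n
    → (S : Subset n) → Collections.𝒯 δ w c k S
    → Σ (Vec (Fin n) k) λ is → image δ ⊤ (concat (toList (map w is))) ≡ S
lemma2 δ w c _ _ _ k _ _ _ S∈𝒯 = Reachability.𝒯-reachable δ w c k S∈𝒯
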